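{- Let $1\le\kappa\le\omega$. The term algebra $\mathcal{F}_\kappa$ of rank $\kappa$ is atomic, i.e. for every finite tuple $\bar a$ from $\mathcal{F}_\kappa$, the type $\mathrm{tp}^{\mathcal{F}_\kappa}(\bar a)$ over $\emptyset$ is isolated by a single formula.
   Context: $\Sigma=\{f_0,\dots,f_k\}$ is a finite purely functional signature, $f_i$ of arity $n_i$, with at least one $f_i$ of arity $\ge2$. For $1\le\kappa\le\omega$, $\mathcal{F}_\kappa$ is the set of ground terms built from $\kappa$ distinct constant symbols using the function symbols of $\Sigma$, with the function symbols interpreted syntactically, regarded as a $\Sigma$-structure (constants not in the language); i.e. the absolutely free $\Sigma$-algebra on $\kappa$ generators. -}

module Defs where

open import Data.Nat using (ℕ; _≤_)
open import Data.Fin using (Fin; zero; suc)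
open import Data.Vec using (Vec; []; _∷_)
open import Data.Product using (Σ; _×_)
open import Data.Sum using (_⊎_)
open import Data.Empty using (⊥)
open import Data.Unit using (⊤)
open import Relation.Binary.PropositionalEquality using (_≡_)

-- A finite purely functional signature: m function symbols f_0 … f_{m-1},
-- symbol i having arity (ar i).  (No constants, no relation symbols
-- other than equality.)

record Structure {m : ℕ} (ar : Fin m → ℕ) : Set₁ where
  field
    Carrier : Set
    fun     : (i : Fin m) → Vec Carrier (ar i) → Carrier
open Structure public

module _ {m : ℕ} (ar : Fin m → ℕ) where

  data FTerm (n : ℕ) : Set where
    var : Fin n → FTerm n
    app : (i : Fin m) → Vec (FTerm n) (ar i) → FTerm n

  data Formula (n : ℕ) : Set where
    _≐_   : FTerm n → FTerm n → Formula n
    ⊥̇     : Formula n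
    _∧̇_   : Formula n → Formula n → Formula n
    _∨̇_   : Formula n → Formula n → Formula n
    _⇒̇_   : Formula n → Formula n → Formula n
    ∀̇     : Formula (ℕ.suc n) → Formula n
    ∃̇     : Formula (ℕ.suc n) → Formula n

module _ {m : ℕ} {ar : Fin m → ℕ} (M : Structure ar) where

  extend : {n : ℕ} → Carrier M → (Fin n → Carrier M) → Fin (ℕ.suc n) → Carrier M
  extend a ρ zero    = a
  extend a ρ (suc i) = ρ i

  mutual
    eval : {n : ℕ} → (Fin n → Carrier M) → FTerm ar n → Carrier M
    eval ρ (var x)    = ρ x
    eval ρ (app i ts) = fun M i (evalVec ρ ts)

    evalVec : {n k : ℕ} → (Fin n → Carrier M) → Vec (FTerm ar n) k → Vec (Carrier M) k
    evalVec ρ []       = []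
    evalVec ρ (t ∷ ts) = eval ρ t ∷ evalVec ρ ts

  Sat : {n : ℕ} → (Fin n → Carrier M) → Formula ar n → Set
  Sat ρ (s ≐ t)  = eval ρ s ≡ eval ρ t
  Sat ρ ⊥̇        = ⊥
  Sat ρ (φ ∧̇ ψ)  = Sat ρ φ × Sat ρ ψ
  Sat ρ (φ ∨̇ ψ)  = Sat ρ φ ⊎ Sat ρ ψ
  Sat ρ (φ ⇒̇ ψ)  = Sat ρ φ → Sat ρ ψ
  Sat ρ (∀̇ φ)    = (a : Carrier M) → Sat (extend a ρ) φ
  Sat ρ (∃̇ φ)    = Σ (Carrier M) (λ a → Sat (extend a ρ) φ)

  -- φ isolates tp^M(ā) over ∅ (relative to the complete theory Th(M)):
  -- M ⊨ φ(ā), and for every ψ ∈ tp(ā), M ⊨ ∀x̄ (φ(x̄) → ψ(x̄)).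
  Isolates : {n : ℕ} → Formula ar n → (Fin n → Carrier M) → Set
  Isolates {n} φ a =
    Sat a φ × ((ψ : Formula ar n) → Sat a ψ →
               (b : Fin n → Carrier M) → Sat b φ → Sat b ψ)

  Atomic : Set
  Atomic = (n : ℕ) (a : Fin n → Carrier M) → Σ (Formula ar n) (λ φ → Isolates φ a)

data Card : Set where
  fin : ℕ → Card
  ω   : Card

PositiveCard : Card → Set
PositiveCard (fin n) = 1 ≤ n
PositiveCard ω       = ⊤

Gen : Card → Set
Gen (fin n) = Fin n
Gen ω       = ℕ

module _ {m : ℕ} (ar : Fin m → ℕ) (G : Set) where

  data GTerm : Set where
    const : G → GTerm
    node  : (i : Fin m) → Vec GTerm (ar i) → GTerm

termAlgebra : {m : ℕ} (ar : Fin m → ℕ) → Card → Structure ar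
termAlgebra ar κ = record { Carrier = GTerm ar (Gen κ) ; fun = node }

{-# OPTIONS --safe #-}

-- Every tuple ā of ground terms arises from a tuple t̄ of terms over r generators by
-- substituting generators c₀ … c_{r-1} for them.  ā satisfies
--   ∃ȳ (every yᵢ is a generator, i.e. lies outside the range of every fᵢ,
--       ∧ yᵢ = yⱼ exactly when cᵢ = cⱼ  ∧  x̄ = t̄(ȳ)),
-- and every b̄ satisfying it is t̄(ē) for generators ē with the same equality pattern as c̄.
-- A permutation of the generators sending c̄ to ē induces an automorphism of the term algebra
-- mapping ā to b̄, and automorphisms preserve all formulas, so this formula isolates tp(ā).

module Submission where

open import Defs
import Data.Nat as ℕ
open import Data.Nat using (ℕ; zero; suc; _+_; _≤_)
import Data.Fin as Fin
open import Data.Fin using (Fin; zero; suc; _↑ˡ_; _↑ʳ_)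
open import Data.Vec using (Vec; []; _∷_; _++_; map; tabulate; lookup)
open import Data.Vec.Properties using (lookup-map; lookup∘tabulate; tabulate-cong; tabulate∘lookup)
import Data.Vec.Functional as Vector
open import Data.Vec.Functional.Properties using (lookup-++ˡ; lookup-++ʳ)
open import Data.Product using (Σ; ∃; _,_; proj₁; proj₂)
open import Data.Product.Function.Dependent.Propositional using (Σ-⇔)
open import Data.Product.Function.NonDependent.Propositional using (_×-⇔_)
open import Data.Sum.Function.Propositional using (_⊎-⇔_)
open import Data.Empty using (⊥; ⊥-elim)
open import Function using (_∘_; id)
open import Function.Bundles using (_↔_; _⇔_; Inverse; Injection; Equivalence; mk⇔; mk↔ₛ′)
open import Function.Construct.Composition using (_↔-∘_; _⇔-∘_)
open import Function.Construct.Identity using (↔-id; ⇔-id)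
open import Function.Construct.Symmetry using (⇔-sym)
open import Function.Properties.Inverse using (↔⇒↠; ↔⇒↣)
open import Function.Related.TypeIsomorphisms using (→-cong-⇔)
open import Relation.Binary.Definitions using (DecidableEquality)
open import Relation.Binary.PropositionalEquality
open import Relation.Nullary using (Dec; yes; no; ¬_)

open Equivalence using (to; from)

module _ {m : ℕ} {ar : Fin m → ℕ} where

  ⋀ : ∀ {n} k → (Fin k → Formula ar n) → Formula ar n
  ⋀ zero    φ = ⊥̇ ⇒̇ ⊥̇
  ⋀ (suc k) φ = φ zero ∧̇ ⋀ k (φ ∘ suc)

  ∃ⁿ : ∀ {n} k → Formula ar (k + n) → Formula ar n
  ∃ⁿ zero    φ = φ
  ∃ⁿ (suc k) φ = ∃ⁿ k (∃̇ φ)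

  holdsIff : ∀ {n} {A : Set} → Dec A → Formula ar n → Formula ar n
  holdsIff (yes _) φ = φ
  holdsIff (no _)  φ = φ ⇒̇ ⊥̇

  vars : ∀ {k n} → (Fin k → Fin n) → Vec (FTerm ar n) k
  vars f = tabulate (var ∘ f)

  InRange : ∀ {n} → Fin m → Fin n → Formula ar n
  InRange {n} i x = ∃ⁿ (ar i) (var (ar i ↑ʳ x) ≐ app i (vars (_↑ˡ n)))

module _ {m : ℕ} {ar : Fin m → ℕ} (M : Structure ar) where

  -- Built from extend rather than Vector._++_ so that it unfolds in step with ∃ⁿ.
  prepend : ∀ {k n} → (Fin k → Carrier M) → (Fin n → Carrier M) → Fin (k + n) → Carrier M
  prepend {zero}  y ρ = ρ
  prepend {suc k} y ρ = extend M (y zero) (prepend (Vector.tail y) ρ)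

  prepend-↑ˡ : ∀ {k n} (y : Fin k → Carrier M) (ρ : Fin n → Carrier M) →
               prepend y ρ ∘ (_↑ˡ n) ≗ y
  prepend-↑ˡ y ρ zero    = refl
  prepend-↑ˡ y ρ (suc i) = prepend-↑ˡ (Vector.tail y) ρ i

  prepend-↑ʳ : ∀ {k n} (y : Fin k → Carrier M) (ρ : Fin n → Carrier M) →
               prepend y ρ ∘ (k ↑ʳ_) ≗ ρ
  prepend-↑ʳ {zero}  y ρ j = refl
  prepend-↑ʳ {suc k} y ρ j = prepend-↑ʳ (Vector.tail y) ρ j

  sat-⋀ : ∀ {n} k (φ : Fin k → Formula ar n) {ρ : Fin n → Carrier M} →
          Sat M ρ (⋀ k φ) ⇔ (∀ i → Sat M ρ (φ i))
  sat-⋀ zero    φ = mk⇔ (λ _ ()) (λ _ → id)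
  sat-⋀ (suc k) φ = mk⇔
    (λ { (s , ss) zero → s ; (s , ss) (suc i) → to (sat-⋀ k (φ ∘ suc)) ss i })
    (λ s → s zero , from (sat-⋀ k (φ ∘ suc)) (s ∘ suc))

  sat-∃ⁿ : ∀ {n} k (φ : Formula ar (k + n)) {ρ : Fin n → Carrier M} →
           Sat M ρ (∃ⁿ k φ) ⇔ ∃ λ y → Sat M (prepend y ρ) φ
  sat-∃ⁿ zero    φ = mk⇔ (λ s → (λ ()) , s) proj₂
  sat-∃ⁿ (suc k) φ = mk⇔
    (λ s → let (y , a , s′) = to (sat-∃ⁿ k (∃̇ φ)) s in a Vector.∷ y , s′)
    (λ (y , s) → from (sat-∃ⁿ k (∃̇ φ)) (Vector.tail y , y zero , s))

  sat-holdsIff : ∀ {n} {A : Set} (d : Dec A) (φ : Formula ar n) {ρ : Fin n → Carrier M} →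
                 Sat M ρ (holdsIff d φ) ⇔ (A ⇔ Sat M ρ φ)
  sat-holdsIff (yes a) φ = mk⇔ (λ s → mk⇔ (λ _ → s) (λ _ → a)) (λ a⇔s → to a⇔s a)
  sat-holdsIff (no ¬a) φ = mk⇔ (λ ¬s → mk⇔ (⊥-elim ∘ ¬a) (⊥-elim ∘ ¬s)) (λ a⇔s → ¬a ∘ from a⇔s)

  evalVec-vars : ∀ {k n} (ρ : Fin n → Carrier M) (f : Fin k → Fin n) →
                 evalVec M ρ (vars f) ≡ tabulate (ρ ∘ f)
  evalVec-vars {zero}  ρ f = refl
  evalVec-vars {suc k} ρ f = cong (ρ (f zero) ∷_) (evalVec-vars ρ (f ∘ suc))

  sat-InRange : ∀ {n} {ρ : Fin n → Carrier M} i x →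
                Sat M ρ (InRange i x) ⇔ ∃ λ xs → ρ x ≡ fun M i xs
  sat-InRange {n} {ρ} i x = mk⇔
    (λ s → let (y , ρx≡fy) = to (sat-∃ⁿ (ar i) _) s in
           tabulate y , trans (sym (prepend-↑ʳ y ρ x)) (trans ρx≡fy (eval-app-vars y)))
    (λ (xs , ρx≡fxs) → from (sat-∃ⁿ (ar i) _) (lookup xs , (begin
      prepend (lookup xs) ρ (ar i ↑ʳ x)                     ≡⟨ prepend-↑ʳ (lookup xs) ρ x ⟩
      ρ x                                                   ≡⟨ ρx≡fxs ⟩
      fun M i xs                                            ≡⟨ cong (fun M i) (tabulate∘lookup xs) ⟨
      fun M i (tabulate (lookup xs))                        ≡⟨ eval-app-vars (lookup xs) ⟨
      eval M (prepend (lookup xs) ρ) (app i (vars (_↑ˡ n))) ∎)))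
    where
    open ≡-Reasoning
    eval-app-vars : ∀ y → eval M (prepend y ρ) (app i (vars (_↑ˡ n))) ≡ fun M i (tabulate y)
    eval-app-vars y = cong (fun M i) (trans (evalVec-vars _ _) (tabulate-cong (prepend-↑ˡ y ρ)))

module _ {m : ℕ} {ar : Fin m → ℕ} {M N : Structure ar} (h : Carrier M ↔ Carrier N)
         (h-hom : ∀ i xs → Inverse.to h (fun M i xs) ≡ fun N i (map (Inverse.to h) xs))
         where

  private module h = Inverse h

  mutual
    eval-hom : ∀ {n} {ρ : Fin n → Carrier M} {ρ′} → ρ′ ≗ h.to ∘ ρ →
               (t : FTerm ar n) → eval N ρ′ t ≡ h.to (eval M ρ t)
    eval-hom ρ′≗ (var x)    = ρ′≗ x
    eval-hom ρ′≗ (app i ts) = trans (cong (fun N i) (evalVec-hom ρ′≗ ts)) (sym (h-hom i _))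

    evalVec-hom : ∀ {n k} {ρ : Fin n → Carrier M} {ρ′} → ρ′ ≗ h.to ∘ ρ →
                  (ts : Vec (FTerm ar n) k) → evalVec N ρ′ ts ≡ map h.to (evalVec M ρ ts)
    evalVec-hom ρ′≗ []       = refl
    evalVec-hom ρ′≗ (t ∷ ts) = cong₂ _∷_ (eval-hom ρ′≗ t) (evalVec-hom ρ′≗ ts)

  extend-hom : ∀ {n} {ρ : Fin n → Carrier M} {ρ′} a → ρ′ ≗ h.to ∘ ρ →
               extend N (h.to a) ρ′ ≗ h.to ∘ extend M a ρ
  extend-hom a ρ′≗ zero    = refl
  extend-hom a ρ′≗ (suc i) = ρ′≗ i

  sat-iso : ∀ {n} (φ : Formula ar n) {ρ : Fin n → Carrier M} {ρ′} → ρ′ ≗ h.to ∘ ρ →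
            Sat M ρ φ ⇔ Sat N ρ′ φ
  sat-iso (s ≐ t) ρ′≗ = mk⇔
    (λ eq → trans (eval-hom ρ′≗ s) (trans (cong h.to eq) (sym (eval-hom ρ′≗ t))))
    (λ eq → Injection.injective (↔⇒↣ h)
              (trans (sym (eval-hom ρ′≗ s)) (trans eq (eval-hom ρ′≗ t))))
  sat-iso ⊥̇       ρ′≗ = ⇔-id ⊥
  sat-iso (φ ∧̇ ψ) ρ′≗ = sat-iso φ ρ′≗ ×-⇔ sat-iso ψ ρ′≗
  sat-iso (φ ∨̇ ψ) ρ′≗ = sat-iso φ ρ′≗ ⊎-⇔ sat-iso ψ ρ′≗
  sat-iso (φ ⇒̇ ψ) ρ′≗ = →-cong-⇔ (sat-iso φ ρ′≗) (sat-iso ψ ρ′≗)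
  sat-iso (∀̇ φ) {ρ′ = ρ′} ρ′≗ = mk⇔
    (λ s b → subst (λ b → Sat N (extend N b ρ′) φ) (h.strictlyInverseˡ b)
                   (to (sat-iso φ (extend-hom (h.from b) ρ′≗)) (s (h.from b))))
    (λ s a → from (sat-iso φ (extend-hom a ρ′≗)) (s (h.to a)))
  sat-iso (∃̇ φ) ρ′≗ = Σ-⇔ (↔⇒↠ h) (sat-iso φ (extend-hom _ ρ′≗))

module _ {G : Set} (_≟_ : DecidableEquality G) where

  transpose : G → G → G → G
  transpose u v w with w ≟ u | w ≟ v
  ... | yes _ | _     = v
  ... | no _  | yes _ = u
  ... | no _  | no _  = w

  transpose-at-u : ∀ u v → transpose u v u ≡ v
  transpose-at-u u v with u ≟ u | u ≟ v
  ... | yes _  | _ = refl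
  ... | no u≢u | _ = ⊥-elim (u≢u refl)

  transpose-at-v : ∀ u v → transpose u v v ≡ u
  transpose-at-v u v with v ≟ u | v ≟ v
  ... | yes v≡u | _      = v≡u
  ... | no _    | yes _  = refl
  ... | no _    | no v≢v = ⊥-elim (v≢v refl)

  transpose-other : ∀ {u v w} → ¬ w ≡ u → ¬ w ≡ v → transpose u v w ≡ w
  transpose-other {u} {v} {w} w≢u w≢v with w ≟ u | w ≟ v
  ... | yes w≡u | _       = ⊥-elim (w≢u w≡u)
  ... | no _    | yes w≡v = ⊥-elim (w≢v w≡v)
  ... | no _    | no _    = refl

  transpose-involutive : ∀ u v w → transpose u v (transpose u v w) ≡ w
  transpose-involutive u v w with w ≟ u | w ≟ v
  ... | yes refl | _        = transpose-at-v u v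
  ... | no _     | yes refl = transpose-at-u u v
  ... | no w≢u   | no w≢v   = transpose-other w≢u w≢v

  transposition : G → G → G ↔ G
  transposition u v = mk↔ₛ′ (transpose u v) (transpose u v)
                            (transpose-involutive u v) (transpose-involutive u v)

  SameEqualityPattern : ∀ {r} → (Fin r → G) → (Fin r → G) → Set
  SameEqualityPattern c e = ∀ i j → c i ≡ c j ⇔ e i ≡ e j

  permutation-extending : ∀ {r} (c e : Fin r → G) → SameEqualityPattern c e →
                          Σ (G ↔ G) λ σ → Inverse.to σ ∘ c ≗ e
  permutation-extending {zero}  c e same = ↔-id G , λ ()
  permutation-extending {suc r} c e same
    with permutation-extending (c ∘ suc) (e ∘ suc) (λ i j → same (suc i) (suc j))
  ... | σ , σc≗e = transposition u (e zero) ↔-∘ σ , extends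
    where
    module σ = Inverse σ
    u = σ.to (c zero)

    extends : ∀ i → transpose u (e zero) (σ.to (c i)) ≡ e i
    extends zero = transpose-at-u u (e zero)
    extends (suc i) with c (suc i) ≟ c zero
    ... | yes cᵢ≡c₀ = begin
      transpose u (e zero) (σ.to (c (suc i))) ≡⟨ cong (transpose u (e zero) ∘ σ.to) cᵢ≡c₀ ⟩
      transpose u (e zero) u                  ≡⟨ transpose-at-u u (e zero) ⟩
      e zero                                  ≡⟨ sym (to (same (suc i) zero) cᵢ≡c₀) ⟩
      e (suc i)                               ∎
      where open ≡-Reasoning
    ... | no cᵢ≢c₀ = begin
      transpose u (e zero) (σ.to (c (suc i))) ≡⟨ cong (transpose u (e zero)) (σc≗e i) ⟩
      transpose u (e zero) (e (suc i))        ≡⟨ transpose-other eᵢ≢u eᵢ≢e₀ ⟩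
      e (suc i)                               ∎
      where
      open ≡-Reasoning
      eᵢ≢u : ¬ e (suc i) ≡ u
      eᵢ≢u eᵢ≡u = cᵢ≢c₀ (Injection.injective (↔⇒↣ σ) (trans (σc≗e i) eᵢ≡u))
      eᵢ≢e₀ : ¬ e (suc i) ≡ e zero
      eᵢ≢e₀ = cᵢ≢c₀ ∘ from (same (suc i) zero)

module _ {m : ℕ} {ar : Fin m → ℕ} where

  FreeAlgebra : Set → Structure ar
  FreeAlgebra G = record { Carrier = GTerm ar G ; fun = node }

  const-injective : ∀ {G} {g h : G} → const {ar = ar} g ≡ const h → g ≡ h
  const-injective refl = refl

  mutual
    rename : ∀ {G H} → (G → H) → GTerm ar G → GTerm ar H
    rename f (const g)   = const (f g)
    rename f (node i ts) = node i (renameVec f ts)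

    renameVec : ∀ {G H k} → (G → H) → Vec (GTerm ar G) k → Vec (GTerm ar H) k
    renameVec f []       = []
    renameVec f (t ∷ ts) = rename f t ∷ renameVec f ts

  renameVec-map : ∀ {G H k} (f : G → H) (ts : Vec (GTerm ar G) k) →
                  renameVec f ts ≡ map (rename f) ts
  renameVec-map f []       = refl
  renameVec-map f (t ∷ ts) = cong (rename f t ∷_) (renameVec-map f ts)

  rename-node : ∀ {G H} (f : G → H) i ts → rename f (node i ts) ≡ node i (map (rename f) ts)
  rename-node f i ts = cong (node i) (renameVec-map f ts)

  mutual
    rename-id : ∀ {G} {f : G → G} → f ≗ id → rename f ≗ id
    rename-id f≗id (const g)   = cong const (f≗id g)
    rename-id f≗id (node i ts) = cong (node i) (renameVec-id f≗id ts)

    renameVec-id : ∀ {G k} {f : G → G} → f ≗ id → (ts : Vec (GTerm ar G) k) → renameVec f ts ≡ ts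
    renameVec-id f≗id []       = refl
    renameVec-id f≗id (t ∷ ts) = cong₂ _∷_ (rename-id f≗id t) (renameVec-id f≗id ts)

  mutual
    rename-∘ : ∀ {G H K} {f : G → H} {g : H → K} {h : G → K} → g ∘ f ≗ h →
               rename g ∘ rename f ≗ rename h
    rename-∘ gf≗h (const x)   = cong const (gf≗h x)
    rename-∘ gf≗h (node i ts) = cong (node i) (renameVec-∘ gf≗h ts)

    renameVec-∘ : ∀ {G H K k} {f : G → H} {g : H → K} {h : G → K} → g ∘ f ≗ h →
                  (ts : Vec (GTerm ar G) k) → renameVec g (renameVec f ts) ≡ renameVec h ts
    renameVec-∘ gf≗h []       = refl
    renameVec-∘ gf≗h (t ∷ ts) = cong₂ _∷_ (rename-∘ gf≗h t) (renameVec-∘ gf≗h ts)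

  rename-↔ : ∀ {G H} → G ↔ H → GTerm ar G ↔ GTerm ar H
  rename-↔ σ = mk↔ₛ′ (rename σ.to) (rename σ.from)
    (λ t → trans (rename-∘ (λ _ → refl) t) (rename-id σ.strictlyInverseˡ t))
    (λ t → trans (rename-∘ (λ _ → refl) t) (rename-id σ.strictlyInverseʳ t))
    where module σ = Inverse σ

  record FiniteSupport {G k} (ts : Vec (GTerm ar G) k) : Set where
    constructor support
    field
      {rank}     : ℕ
      generators : Fin rank → G
      shape      : Vec (GTerm ar (Fin rank)) k
      renames-to : ts ≡ renameVec generators shape

  renameVec-++ : ∀ {G H k l} (f : G → H) (xs : Vec (GTerm ar G) k) (ys : Vec (GTerm ar G) l) →
                 renameVec f (xs ++ ys) ≡ renameVec f xs ++ renameVec f ys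
  renameVec-++ f []       ys = refl
  renameVec-++ f (x ∷ xs) ys = cong (rename f x ∷_) (renameVec-++ f xs ys)

  ++-support : ∀ {G k l} {xs : Vec (GTerm ar G) k} {ys : Vec (GTerm ar G) l} →
               FiniteSupport xs → FiniteSupport ys → FiniteSupport (xs ++ ys)
  ++-support {xs = xs} {ys} (support {r₁} c₁ s₁ xs≡) (support {r₂} c₂ s₂ ys≡) =
    support c (renameVec (_↑ˡ r₂) s₁ ++ renameVec (r₁ ↑ʳ_) s₂) (begin
      xs ++ ys
        ≡⟨ cong₂ _++_ xs≡ ys≡ ⟩
      renameVec c₁ s₁ ++ renameVec c₂ s₂
        ≡⟨ cong₂ _++_ (renameVec-∘ (lookup-++ˡ c₁ c₂) s₁) (renameVec-∘ (lookup-++ʳ c₁ c₂) s₂) ⟨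
      renameVec c (renameVec (_↑ˡ r₂) s₁) ++ renameVec c (renameVec (r₁ ↑ʳ_) s₂)
        ≡⟨ renameVec-++ c (renameVec (_↑ˡ r₂) s₁) (renameVec (r₁ ↑ʳ_) s₂) ⟨
      renameVec c (renameVec (_↑ˡ r₂) s₁ ++ renameVec (r₁ ↑ʳ_) s₂) ∎)
    where
    open ≡-Reasoning
    c = c₁ Vector.++ c₂

  finiteSupport : ∀ {G k} (ts : Vec (GTerm ar G) k) → FiniteSupport ts
  finiteSupport []                = support {rank = 0} (λ ()) [] refl
  finiteSupport (const g   ∷ ts) =
    ++-support (support {rank = 1} (λ _ → g) (const zero ∷ []) refl) (finiteSupport ts)
  finiteSupport (node i us ∷ ts) = ++-support node-support (finiteSupport ts)
    where
    node-support : FiniteSupport (node i us ∷ [])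
    node-support with finiteSupport us
    ... | support c s us≡ = support c (node i s ∷ []) (cong (λ vs → node i vs ∷ []) us≡)

module _ {m : ℕ} {ar : Fin m → ℕ} {G : Set} (_≟_ : DecidableEquality G) where

  private
    F = FreeAlgebra {ar = ar} G

  IsGenerator : ∀ {n} → Fin n → Formula ar n
  IsGenerator x = ⋀ m λ i → InRange i x ⇒̇ ⊥̇

  sat-IsGenerator : ∀ {n} {ρ : Fin n → GTerm ar G} x →
                    Sat F ρ (IsGenerator x) ⇔ ∃ λ g → ρ x ≡ const g
  sat-IsGenerator {ρ = ρ} x = mk⇔ generator not-in-range
    where
    generator : Sat F ρ (IsGenerator x) → ∃ λ g → ρ x ≡ const g
    generator s with ρ x in ρx≡
    ... | const g   = g , refl
    ... | node i ts = ⊥-elim (to (sat-⋀ F m _) s i (from (sat-InRange F i x) (ts , ρx≡)))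

    not-in-range : (∃ λ g → ρ x ≡ const g) → Sat F ρ (IsGenerator x)
    not-in-range (g , ρx≡g) = from (sat-⋀ F m _) λ i s →
      let (ts , ρx≡fts) = to (sat-InRange F i x) s in const≢node (trans (sym ρx≡g) ρx≡fts)
      where
      const≢node : ∀ {g i ts} → const g ≢ node i ts
      const≢node ()

  mutual
    toFTerm : ∀ {r n} → GTerm ar (Fin r) → FTerm ar (r + n)
    toFTerm {n = n} (const i) = var (i ↑ˡ n)
    toFTerm (node i ts)       = app i (toFTerms ts)

    toFTerms : ∀ {r n k} → Vec (GTerm ar (Fin r)) k → Vec (FTerm ar (r + n)) k
    toFTerms []       = []
    toFTerms (t ∷ ts) = toFTerm t ∷ toFTerms ts

  mutual
    eval-toFTerm : ∀ {r n} {ρ : Fin (r + n) → GTerm ar G} {e : Fin r → G} →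
                   ρ ∘ (_↑ˡ n) ≗ const ∘ e → (t : GTerm ar (Fin r)) →
                   eval F ρ (toFTerm t) ≡ rename e t
    eval-toFTerm ρ≗e (const i)   = ρ≗e i
    eval-toFTerm ρ≗e (node i ts) = cong (node i) (evalVec-toFTerms ρ≗e ts)

    evalVec-toFTerms : ∀ {r n k} {ρ : Fin (r + n) → GTerm ar G} {e : Fin r → G} →
                       ρ ∘ (_↑ˡ n) ≗ const ∘ e → (ts : Vec (GTerm ar (Fin r)) k) →
                       evalVec F ρ (toFTerms ts) ≡ renameVec e ts
    evalVec-toFTerms ρ≗e []       = refl
    evalVec-toFTerms ρ≗e (t ∷ ts) = cong₂ _∷_ (eval-toFTerm ρ≗e t) (evalVec-toFTerms ρ≗e ts)

  EqualityPattern : ∀ {r n} → (Fin r → G) → Formula ar (r + n)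
  EqualityPattern {r} {n} c = ⋀ r λ i → ⋀ r λ j → holdsIff (c i ≟ c j) (var (i ↑ˡ n) ≐ var (j ↑ˡ n))

  sat-EqualityPattern : ∀ {r n} {ρ : Fin (r + n) → GTerm ar G} {e : Fin r → G} (c : Fin r → G) →
                        ρ ∘ (_↑ˡ n) ≗ const ∘ e →
                        Sat F ρ (EqualityPattern c) ⇔ SameEqualityPattern _≟_ c e
  sat-EqualityPattern {r} {n} {ρ} {e} c ρ≗e = mk⇔
    (λ s i j → ρᵢⱼ⇔eᵢⱼ ⇔-∘ to (sat-holdsIff F _ _) (to (sat-⋀ F r _) (to (sat-⋀ F r _) s i) j))
    (λ same → from (sat-⋀ F r _) λ i → from (sat-⋀ F r _) λ j →
                from (sat-holdsIff F _ _) (⇔-sym ρᵢⱼ⇔eᵢⱼ ⇔-∘ same i j))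
    where
    ρᵢⱼ⇔eᵢⱼ : ∀ {i j} → ρ (i ↑ˡ n) ≡ ρ (j ↑ˡ n) ⇔ e i ≡ e j
    ρᵢⱼ⇔eᵢⱼ {i} {j} = mk⇔
      (λ eq → const-injective (trans (sym (ρ≗e i)) (trans eq (ρ≗e j))))
      (λ eq → trans (ρ≗e i) (trans (cong const eq) (sym (ρ≗e j))))

  IsolatorBody : ∀ {r n} → (Fin r → G) → (Fin n → GTerm ar (Fin r)) → Formula ar (r + n)
  IsolatorBody {r} {n} c t =
    ⋀ r (IsGenerator ∘ (_↑ˡ n)) ∧̇ (EqualityPattern c ∧̇ ⋀ n λ j → var (r ↑ʳ j) ≐ toFTerm (t j))

  Isolator : ∀ {r n} → (Fin r → G) → (Fin n → GTerm ar (Fin r)) → Formula ar n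
  Isolator {r} c t = ∃ⁿ r (IsolatorBody c t)

  isolator-sat : ∀ {r n} {a : Fin n → GTerm ar G} {c : Fin r → G} {t} →
                 a ≗ rename c ∘ t → Sat F a (Isolator c t)
  isolator-sat {r} {n} {a} {c} {t} a≗ct =
    from (sat-∃ⁿ F r _) (const ∘ c , generators , samePattern , equations)
    where
    E : Fin (r + n) → GTerm ar G
    E = prepend F (const ∘ c) a
    E≗c : E ∘ (_↑ˡ n) ≗ const ∘ c
    E≗c = prepend-↑ˡ F (const ∘ c) a
    generators : Sat F E (⋀ r (IsGenerator ∘ (_↑ˡ n)))
    generators = from (sat-⋀ F r _) λ i → from (sat-IsGenerator (i ↑ˡ n)) (c i , E≗c i)
    samePattern : Sat F E (EqualityPattern c)
    samePattern = from (sat-EqualityPattern c E≗c) λ i j → ⇔-id _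
    equations : Sat F E (⋀ n λ j → var (r ↑ʳ j) ≐ toFTerm (t j))
    equations = from (sat-⋀ F n _) λ j →
      trans (prepend-↑ʳ F (const ∘ c) a j) (trans (a≗ct j) (sym (eval-toFTerm E≗c (t j))))

  isolator-realizers-conjugate : ∀ {r n} {a b : Fin n → GTerm ar G} {c : Fin r → G} {t} →
                                 a ≗ rename c ∘ t → Sat F b (Isolator c t) →
                                 Σ (G ↔ G) λ σ → b ≗ rename (Inverse.to σ) ∘ a
  isolator-realizers-conjugate {r} {n} {a} {b} {c} {t} a≗ct s = realizers (to (sat-∃ⁿ F r _) s)
    where
    realizers : (∃ λ y → Sat F (prepend F y b) (IsolatorBody c t)) →
                Σ (G ↔ G) λ σ → b ≗ rename (Inverse.to σ) ∘ a
    realizers (y , generators , samePattern , equations) = σ , b≗σa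
      where
      E : Fin (r + n) → GTerm ar G
      E = prepend F y b
      isGenerator : ∀ i → ∃ λ g → E (i ↑ˡ n) ≡ const g
      isGenerator i = to (sat-IsGenerator (i ↑ˡ n)) (to (sat-⋀ F r _) generators i)
      e : Fin r → G
      e = proj₁ ∘ isGenerator
      E≗e : E ∘ (_↑ˡ n) ≗ const ∘ e
      E≗e = proj₂ ∘ isGenerator
      extension : Σ (G ↔ G) λ σ → Inverse.to σ ∘ c ≗ e
      extension = permutation-extending _≟_ c e (to (sat-EqualityPattern c E≗e) samePattern)
      σ : G ↔ G
      σ = proj₁ extension
      open ≡-Reasoning
      b≗σa : b ≗ rename (Inverse.to σ) ∘ a
      b≗σa j = begin
        b j                                    ≡⟨ prepend-↑ʳ F y b j ⟨
        E (r ↑ʳ j)                             ≡⟨ to (sat-⋀ F n _) equations j ⟩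
        eval F E (toFTerm (t j))               ≡⟨ eval-toFTerm E≗e (t j) ⟩
        rename e (t j)                         ≡⟨ rename-∘ (proj₂ extension) (t j) ⟨
        rename (Inverse.to σ) (rename c (t j)) ≡⟨ cong (rename (Inverse.to σ)) (a≗ct j) ⟨
        rename (Inverse.to σ) (a j)            ∎

  isolator-isolates : ∀ {r n} {a : Fin n → GTerm ar G} {c : Fin r → G} {t} →
                      a ≗ rename c ∘ t → Isolates F (Isolator c t) a
  isolator-isolates a≗ct = isolator-sat a≗ct , λ ψ ψa b sb →
    let (σ , b≗σa) = isolator-realizers-conjugate a≗ct sb
    in to (sat-iso (rename-↔ σ) (rename-node (Inverse.to σ)) ψ b≗σa) ψa

  freeAlgebra-atomic : Atomic F
  freeAlgebra-atomic n a = Isolator generators (lookup shape) , isolator-isolates a≗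
    where
    open FiniteSupport (finiteSupport (tabulate a))
    a≗ : a ≗ rename generators ∘ lookup shape
    a≗ j = begin
      a j                                      ≡⟨ lookup∘tabulate a j ⟨
      lookup (tabulate a) j                    ≡⟨ cong (λ ts → lookup ts j) renames-to ⟩
      lookup (renameVec generators shape) j    ≡⟨ cong (λ ts → lookup ts j) (renameVec-map _ shape) ⟩
      lookup (map (rename generators) shape) j ≡⟨ lookup-map j (rename generators) shape ⟩
      rename generators (lookup shape j)       ∎
      where open ≡-Reasoning

mainTheorem5 : (m : ℕ) (ar : Fin m → ℕ) → ∃ (λ i → 2 ≤ ar i) →
    (κ : Card) → PositiveCard κ → Atomic (termAlgebra ar κ)
mainTheorem5 m ar _ κ _ = freeAlgebra-atomic (≟-Gen κ)
  where
  ≟-Gen : ∀ κ → DecidableEquality (Gen κ)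
  ≟-Gen (fin k) = Fin._≟_
  ≟-Gen ω       = ℕ._≟_
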